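{- If $(\mathbb{A},D)$ is a designated $\mathsf{Cobounded}$-algebra in which $D$ contains at least two elements, then the logic $\mathbf{L}(\mathbb{A},D)$ is paraconsistent: there exist propositional formulas $\alpha,\beta$ with $(\alpha\wedge\neg\alpha)\to\beta\notin\mathbf{L}(\mathbb{A},D)$.
   Context: A designated set is a lattice filter $D$ with $\mathbf{1}\in D$, $\mathbf{0}\notin D$. A $\mathsf{Cobounded}$-algebra is $\langle\mathbf{A},\wedge,\vee,\Rightarrow,\mathbf{1},\mathbf{0}\rangle$ with complete distributive lattice reduct, such that $\bigvee_i a_i=\mathbf{1}$ implies some $a_j=\mathbf{1}$, $\bigwedge_i a_i=\mathbf{0}$ implies some $a_j=\mathbf{0}$, and $a\Rightarrow b=\mathbf{0}$ if $a\ne\mathbf{0},b=\mathbf{0}$, else $\mathbf{1}$. A designated $\mathsf{Cobounded}$-algebra $(\mathbb{A},D)$, $\mathbb{A}=\langle\mathbf{A},\wedge,\vee,\Rightarrow,{}^*,\mathbf{1},\mathbf{0}\rangle$, adds ${}^*$: $a^*=\mathbf{0}$ if $a=\mathbf{1}$, $a^*=a$ if $a\in D\setminus\{\mathbf{1}\}$, $a^*=\mathbf{1}$ if $a\notin D$. Propositional formulas are built from variables with $\wedge,\vee,\to,\neg,\top,\bot$; a valuation is a homomorphism into $\mathbb{A}$ (interpreting $\to,\neg$ by $\Rightarrow,{}^*$). $\mathbf{L}(\mathbb{A},D)$ is the set of propositional formulas $\alpha$ with $v(\alpha)\in D$ for every valuation $v$. -}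

module Defs where

open import Level using (Level; _⊔_; suc)
open import Data.Nat using (ℕ)
open import Data.Product using (Σ; ∃; _×_)
open import Data.Sum using (_⊎_)
open import Relation.Nullary using (¬_)
open import Relation.Unary using (Pred; _∈_; _∉_)
open import Algebra.Lattice.Bundles using (DistributiveLattice)

-- Completeness: every family indexed by
-- a type I : Set c (in particular every subset of the carrier) has a
-- join ⋁ and a meet ⋀.
record CoboundedAlgebra (c ℓ : Level) : Set (suc (c ⊔ ℓ)) where
  field
    lat : DistributiveLattice c ℓ
  open DistributiveLattice lat public
  infix 4 _≤_
  _≤_ : Carrier → Carrier → Set ℓ
  a ≤ b = (a ∧ b) ≈ a
  field
    𝟏 𝟎 : Carrier
    𝟏-top : ∀ a → a ≤ 𝟏
    𝟎-bot : ∀ a → 𝟎 ≤ a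
    ⋁ : {I : Set c} → (I → Carrier) → Carrier
    ⋁-upper : {I : Set c} (f : I → Carrier) (i : I) → f i ≤ ⋁ f
    ⋁-least : {I : Set c} (f : I → Carrier) (b : Carrier) → (∀ i → f i ≤ b) → ⋁ f ≤ b
    ⋀ : {I : Set c} → (I → Carrier) → Carrier
    ⋀-lower : {I : Set c} (f : I → Carrier) (i : I) → ⋀ f ≤ f i
    ⋀-greatest : {I : Set c} (f : I → Carrier) (b : Carrier) → (∀ i → b ≤ f i) → b ≤ ⋀ f
    ⋁-cobounded : {I : Set c} (f : I → Carrier) → ⋁ f ≈ 𝟏 → ∃ λ j → f j ≈ 𝟏
    ⋀-cobounded : {I : Set c} (f : I → Carrier) → ⋀ f ≈ 𝟎 → ∃ λ j → f j ≈ 𝟎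
    _⇒_ : Carrier → Carrier → Carrier
    ⇒-𝟎 : ∀ a b → ¬ (a ≈ 𝟎) → b ≈ 𝟎 → (a ⇒ b) ≈ 𝟎
    ⇒-𝟏 : ∀ a b → ¬ (¬ (a ≈ 𝟎) × b ≈ 𝟎) → (a ⇒ b) ≈ 𝟏

record IsDesignated {c ℓ ℓD} (𝔸 : CoboundedAlgebra c ℓ)
                    (D : Pred (CoboundedAlgebra.Carrier 𝔸) ℓD) : Set (c ⊔ ℓ ⊔ ℓD) where
  open CoboundedAlgebra 𝔸
  field
    up-closed : ∀ {a b} → a ∈ D → a ≤ b → b ∈ D
    ∧-closed  : ∀ {a b} → a ∈ D → b ∈ D → (a ∧ b) ∈ D
    𝟏∈D : 𝟏 ∈ D
    𝟎∉D : 𝟎 ∉ D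

record DesignatedCobounded (c ℓ ℓD : Level) : Set (suc (c ⊔ ℓ ⊔ ℓD)) where
  field
    alg : CoboundedAlgebra c ℓ
  open CoboundedAlgebra alg public
  field
    D : Pred Carrier ℓD
    isDesignated : IsDesignated alg D
    _* : Carrier → Carrier
    *-𝟏 : ∀ a → a ≈ 𝟏 → (a *) ≈ 𝟎
    *-D : ∀ a → a ∈ D → ¬ (a ≈ 𝟏) → (a *) ≈ a
    *-notD : ∀ a → a ∉ D → (a *) ≈ 𝟏

data Formula : Set where
  var : ℕ → Formula
  _∧f_ _∨f_ _→f_ : Formula → Formula → Formula
  ¬f_ : Formula → Formula
  ⊤f ⊥f : Formula

module _ {c ℓ ℓD} (𝔸 : DesignatedCobounded c ℓ ℓD) where
  open DesignatedCobounded 𝔸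

  eval : (ℕ → Carrier) → Formula → Carrier
  eval v (var n) = v n
  eval v (φ ∧f ψ) = eval v φ ∧ eval v ψ
  eval v (φ ∨f ψ) = eval v φ ∨ eval v ψ
  eval v (φ →f ψ) = eval v φ ⇒ eval v ψ
  eval v (¬f φ) = (eval v φ) *
  eval v ⊤f = 𝟏
  eval v ⊥f = 𝟎

  L : Pred Formula (c ⊔ ℓD)
  L φ = ∀ (v : ℕ → Carrier) → eval v φ ∈ D

{-# OPTIONS --safe #-}
module Submission where

-- A designated element a ≠ 𝟏 is a fixed point of ^*, so under the constant
-- valuation a the contradiction p ∧ ¬p takes the designated, hence nonzero,
-- value a, and (p ∧ ¬p) → ⊥ evaluates to 𝟎 ∉ D.  Of two distinct designated
-- elements at least one differs from 𝟏.

open import Defs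
open import Data.Product using (∃; _×_; _,_)
open import Relation.Nullary using (¬_)
open import Relation.Unary using (Pred; _∈_; _∉_)
import Algebra.Lattice.Properties.DistributiveLattice as DistributiveLatticeProperties

module _ {c ℓ} (𝔸 : CoboundedAlgebra c ℓ) where
  open CoboundedAlgebra 𝔸
  open DistributiveLatticeProperties lat using (∧-idem)

  ≈⇒≤ : ∀ {x y} → x ≈ y → x ≤ y
  ≈⇒≤ {x} x≈y = trans (∧-congˡ (sym x≈y)) (∧-idem x)

module _ {c ℓ ℓD} {𝔸 : CoboundedAlgebra c ℓ} {D : Pred (CoboundedAlgebra.Carrier 𝔸) ℓD}
         (isDesignated : IsDesignated 𝔸 D) where
  open CoboundedAlgebra 𝔸
  open IsDesignated isDesignated

  designated-resp-≈ : ∀ {x y} → x ∈ D → x ≈ y → y ∈ D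
  designated-resp-≈ x∈D x≈y = up-closed x∈D (≈⇒≤ 𝔸 x≈y)

  designated⇒≉𝟎 : ∀ {x} → x ∈ D → ¬ (x ≈ 𝟎)
  designated⇒≉𝟎 x∈D x≈𝟎 = 𝟎∉D (designated-resp-≈ x∈D x≈𝟎)

  -- Which of the two elements differs from 𝟏 is not decidable, hence the
  -- double negation.
  two-designated⇒¬all-designated-≈𝟏 :
    (∃ λ d → ∃ λ e → d ∈ D × e ∈ D × ¬ (d ≈ e)) →
    ¬ (∀ {a} → a ∈ D → ¬ ¬ (a ≈ 𝟏))
  two-designated⇒¬all-designated-≈𝟏 (d , e , d∈D , e∈D , d≉e) all≈𝟏 =
    all≈𝟏 d∈D λ d≈𝟏 → all≈𝟏 e∈D λ e≈𝟏 → d≉e (trans d≈𝟏 (sym e≈𝟏))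

module _ {c ℓ ℓD} (𝔸 : DesignatedCobounded c ℓ ℓD) where
  open DesignatedCobounded 𝔸
  open IsDesignated isDesignated
  open DistributiveLatticeProperties lat using (∧-idem)

  ∧*-fixed : ∀ {a} → a ∈ D → ¬ (a ≈ 𝟏) → (a ∧ a *) ≈ a
  ∧*-fixed {a} a∈D a≉𝟏 = trans (∧-congˡ (*-D a a∈D a≉𝟏)) (∧-idem a)

  explosion : Formula
  explosion = (var 0 ∧f (¬f var 0)) →f ⊥f

  explosion-refuted : ∀ {a} → a ∈ D → ¬ (a ≈ 𝟏) → explosion ∉ L 𝔸
  explosion-refuted {a} a∈D a≉𝟏 explosion∈L =
    𝟎∉D (designated-resp-≈ isDesignated (explosion∈L (λ _ → a)) value≈𝟎)
    where
    contradiction∈D : (a ∧ a *) ∈ D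
    contradiction∈D = designated-resp-≈ isDesignated a∈D (sym (∧*-fixed a∈D a≉𝟏))

    value≈𝟎 : ((a ∧ a *) ⇒ 𝟎) ≈ 𝟎
    value≈𝟎 = ⇒-𝟎 _ _ (designated⇒≉𝟎 isDesignated contradiction∈D) refl

mainTheorem9 : ∀ {c ℓ ℓD} (𝔸 : DesignatedCobounded c ℓ ℓD) →
    let open DesignatedCobounded 𝔸 in
    (∃ λ d → ∃ λ e → d ∈ D × e ∈ D × ¬ (d ≈ e)) →
    ∃ λ α → ∃ λ β → ((α ∧f (¬f α)) →f β) ∉ L 𝔸
mainTheorem9 𝔸 twoDesignated = var 0 , ⊥f , λ explosion∈L →
  two-designated⇒¬all-designated-≈𝟏 isDesignated twoDesignated
    λ a∈D a≉𝟏 → explosion-refuted 𝔸 a∈D a≉𝟏 explosion∈L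
  where open DesignatedCobounded 𝔸
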